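{- Let $n\ge 3$ and let $t$ be an integer with $3\le t\le n$. Assign threshold $t$ to every vertex of $K_{1,n}\Box K_{1,n}$. Then $dyn_t(K_{1,n}\Box K_{1,n})=n^2$.
   Context: $K_{1,n}$ is the star with one center and $n$ leaves; $G\Box H$ is the Cartesian product (vertex set $V(G)\times V(H)$, $(u,v)\sim(u',v')$ iff $u=u'$ and $vv'\in E(H)$, or $v=v'$ and $uu'\in E(G)$). For constant threshold $t$, a set $D$ of vertices is a $t$-dynamic monopoly if starting from $D$ and repeatedly adding any vertex having at least $t$ neighbors in the current set eventually yields all vertices (a vertex of degree less than $t$ can thus only belong to the final set by being in $D$); $dyn_t$ is the minimum size of a $t$-dynamic monopoly. -}

module Defs where

open import Level using (0ℓ)
open import Data.Nat using (ℕ; zero; suc)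
open import Data.Fin using (Fin; zero; suc)
open import Data.Product using (_×_; _,_; proj₁; proj₂; ∃-syntax)
open import Data.Sum using (_⊎_)
open import Data.List using (List; length)
open import Data.List.Relation.Unary.All using (All)
open import Data.List.Relation.Unary.Unique.Propositional using (Unique)
open import Data.List.Membership.Propositional using (_∈_)
open import Relation.Binary.PropositionalEquality using (_≡_; _≢_)

record Graph : Set₁ where
  field
    V   : Set
    Adj : V → V → Set
open Graph public

Star : ℕ → Graph
Star n = record
  { V   = Fin (suc n)
  ; Adj = λ i j → (i ≡ zero × j ≢ zero) ⊎ (j ≡ zero × i ≢ zero)
  }

_□_ : Graph → Graph → Graph
G □ H = record
  { V   = V G × V H
  ; Adj = λ p q → (proj₁ p ≡ proj₁ q × Adj H (proj₂ p) (proj₂ q))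
                ⊎ (proj₂ p ≡ proj₂ q × Adj G (proj₁ p) (proj₁ q))
  }

data Activated (G : Graph) (t : ℕ) (D : List (V G)) : V G → Set where
  seed : ∀ {v} → v ∈ D → Activated G t D v
  step : ∀ {v} (L : List (V G)) → Unique L → length L ≡ t →
         All (Adj G v) L → All (Activated G t D) L → Activated G t D v

IsDynMonopoly : (G : Graph) → ℕ → List (V G) → Set
IsDynMonopoly G t D = ∀ v → Activated G t D v

-- dyn_t(G) = k : k is the minimum size of a t-dynamic monopoly
-- (sets represented as duplicate-free lists; size = length).
DynEq : (G : Graph) → ℕ → ℕ → Set
DynEq G t k =
  (∃[ D ] (Unique D × IsDynMonopoly G t D × length D ≡ k))
  × (∀ D → Unique D → IsDynMonopoly G t D → k Data.Nat.≤ length D)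

-- A vertex (i , j) with both coordinates leaves has only two neighbours, (i , 0) and (0 , j);
-- since t ≥ 3 it is activated only if seeded, so every t-dynamic monopoly contains all n² such
-- vertices. Conversely these n² vertices suffice when t ≤ n: each (0 , j) and (i , 0) with j, i
-- leaves then has n activated neighbours, after which the same holds for (0 , 0).
module Submission where

open import Defs
open import Data.Nat using (ℕ; suc; _≤_; _<_; _+_; _*_; _⊓_)
open import Data.Nat.Properties using (≤⇒≯; m≤n⇒m⊓n≡m)
open import Data.Fin using (Fin; zero; suc)
open import Data.Fin.Properties using (suc-injective; injective⇒≤)
open import Data.Product using (_×_; _,_; proj₁; proj₂; ∃₂)
open import Data.Sum using (inj₁; inj₂)
open import Data.List using (List; []; _∷_; _++_; length; lookup; map; take; tabulate; cartesianProduct)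
open import Data.List.Properties using (length-++; length-map; length-take; length-tabulate)
import Data.List.Relation.Unary.All as All
import Data.List.Relation.Unary.All.Properties as All
open import Data.List.Relation.Unary.Any using (here; there; index)
open import Data.List.Relation.Unary.Any.Properties using (lookup-index)
open import Data.List.Relation.Unary.AllPairs using (_∷_)
open import Data.List.Relation.Unary.Unique.Propositional using (Unique)
import Data.List.Relation.Unary.Unique.Propositional.Properties as Unique
open import Data.List.Relation.Binary.Subset.Propositional using (_⊆_)
open import Data.List.Membership.Propositional using (_∈_)
open import Data.List.Membership.Propositional.Properties
  using (∈-lookup; ∈-cartesianProduct⁺; ∈-cartesianProduct⁻; ∈-tabulate⁺; ∈-tabulate⁻)
open import Function using (_∘_)
open import Function.Definitions using (Injective)
open import Relation.Nullary using (contradiction)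
open import Relation.Binary.PropositionalEquality using (_≡_; refl; sym; trans; cong; cong₂; subst; module ≡-Reasoning)

module _ {A : Set} where

  Unique⇒lookup-injective : {xs : List A} → Unique xs → Injective _≡_ _≡_ (lookup xs)
  Unique⇒lookup-injective (_ ∷ _)    {zero}  {zero}  _  = refl
  Unique⇒lookup-injective (x∉ ∷ _)   {zero}  {suc j} eq = contradiction eq (All.lookup x∉ (∈-lookup j))
  Unique⇒lookup-injective (x∉ ∷ _)   {suc i} {zero}  eq = contradiction (sym eq) (All.lookup x∉ (∈-lookup i))
  Unique⇒lookup-injective (_ ∷ uniq) {suc i} {suc j} eq = cong suc (Unique⇒lookup-injective uniq eq)

  unique-⊆⇒length≤ : {xs ys : List A} → Unique xs → xs ⊆ ys → length xs ≤ length ys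
  unique-⊆⇒length≤ {xs} {ys} uniq xs⊆ys = injective⇒≤ position-injective
    where
    position : Fin (length xs) → Fin (length ys)
    position i = index (xs⊆ys (∈-lookup i))

    position-injective : Injective _≡_ _≡_ position
    position-injective {i} {j} eq = Unique⇒lookup-injective uniq (begin
      lookup xs i             ≡⟨ lookup-index (xs⊆ys (∈-lookup i)) ⟩
      lookup ys (position i)  ≡⟨ cong (lookup ys) eq ⟩
      lookup ys (position j)  ≡⟨ sym (lookup-index (xs⊆ys (∈-lookup j))) ⟩
      lookup xs j             ∎)
      where open ≡-Reasoning

  length-cartesianProduct : {B : Set} (xs : List A) (ys : List B) →
                            length (cartesianProduct xs ys) ≡ length xs * length ys
  length-cartesianProduct []       ys = refl
  length-cartesianProduct (x ∷ xs) ys = begin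
    length (map (x ,_) ys ++ cartesianProduct xs ys)          ≡⟨ length-++ (map (x ,_) ys) ⟩
    length (map (x ,_) ys) + length (cartesianProduct xs ys)  ≡⟨ cong₂ _+_ (length-map (x ,_) ys) (length-cartesianProduct xs ys) ⟩
    length ys + length xs * length ys                         ∎
    where open ≡-Reasoning

module _ {G : Graph} {t : ℕ} {D : List (V G)} where

  activated-by-family : ∀ {v m} {f : Fin m → V G} → t ≤ m → Injective _≡_ _≡_ f →
                        (∀ i → Adj G v (f i)) → (∀ i → Activated G t D (f i)) →
                        Activated G t D v
  activated-by-family {m = m} {f} t≤m f-injective adjacent activated =
    step (take t (tabulate f))
         (Unique.take⁺ t (Unique.tabulate⁺ f-injective))
         length-take-t
         (All.take⁺ t (All.tabulate⁺ adjacent))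
         (All.take⁺ t (All.tabulate⁺ activated))
    where
    length-take-t : length (take t (tabulate f)) ≡ t
    length-take-t = begin
      length (take t (tabulate f))  ≡⟨ length-take t (tabulate f) ⟩
      t ⊓ length (tabulate f)       ≡⟨ cong (t ⊓_) (length-tabulate f) ⟩
      t ⊓ m                         ≡⟨ m≤n⇒m⊓n≡m t≤m ⟩
      t                             ∎
      where open ≡-Reasoning

  activated-few-neighbours⇒seed : ∀ {v} {N : List (V G)} → (∀ {w} → Adj G v w → w ∈ N) →
                                  length N < t → Activated G t D v → v ∈ D
  activated-few-neighbours⇒seed _          _   (seed v∈D)               = v∈D
  activated-few-neighbours⇒seed neighbours N<t (step L uniq refl adj _) =
    contradiction N<t (≤⇒≯ (unique-⊆⇒length≤ uniq (All.lookup (All.map neighbours adj))))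

module _ {G H : Graph} {a : V G} {b : V H} where

  □-adjˡ : ∀ {a′} → Adj G a a′ → Adj (G □ H) (a , b) (a′ , b)
  □-adjˡ adj = inj₂ (refl , adj)

  □-adjʳ : ∀ {b′} → Adj H b b′ → Adj (G □ H) (a , b) (a , b′)
  □-adjʳ adj = inj₁ (refl , adj)

module StarSquare (n : ℕ) where

  centre-adj-leaf : (i : Fin n) → Adj (Star n) zero (suc i)
  centre-adj-leaf i = inj₁ (refl , λ ())

  leaves : List (Fin (suc n))
  leaves = tabulate suc

  length-leaves : length leaves ≡ n
  length-leaves = length-tabulate suc

  leafSquare : List (Fin (suc n) × Fin (suc n))
  leafSquare = cartesianProduct leaves leaves

  leafSquare-unique : Unique leafSquare
  leafSquare-unique = Unique.cartesianProduct⁺ (Unique.tabulate⁺ suc-injective) (Unique.tabulate⁺ suc-injective)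

  length-leafSquare : length leafSquare ≡ n * n
  length-leafSquare = trans (length-cartesianProduct leaves leaves)
                            (cong₂ _*_ length-leaves length-leaves)

  ∈-leafSquare⁺ : (i j : Fin n) → (suc i , suc j) ∈ leafSquare
  ∈-leafSquare⁺ i j = ∈-cartesianProduct⁺ (∈-tabulate⁺ i) (∈-tabulate⁺ j)

  ∈-leafSquare⁻ : ∀ {v} → v ∈ leafSquare → ∃₂ λ i j → v ≡ (suc i , suc j)
  ∈-leafSquare⁻ v∈ with ∈-cartesianProduct⁻ leaves leaves v∈
  ... | a∈ , b∈ with ∈-tabulate⁻ a∈ | ∈-tabulate⁻ b∈
  ... | i , refl | j , refl = i , j , refl

  leafSquare-neighbours : ∀ {i j : Fin n} {w} → Adj (Star n □ Star n) (suc i , suc j) w →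
                          w ∈ (suc i , zero) ∷ (zero , suc j) ∷ []
  leafSquare-neighbours (inj₁ (refl , inj₁ (() , _)))
  leafSquare-neighbours (inj₁ (refl , inj₂ (refl , _))) = here refl
  leafSquare-neighbours (inj₂ (refl , inj₁ (() , _)))
  leafSquare-neighbours (inj₂ (refl , inj₂ (refl , _))) = there (here refl)

  module _ {t : ℕ} (t≤n : t ≤ n) where

    private
      Activated□ : Fin (suc n) × Fin (suc n) → Set
      Activated□ = Activated (Star n □ Star n) t leafSquare

    centre-leaf-activated : (j : Fin n) → Activated□ (zero , suc j)
    centre-leaf-activated j = activated-by-family t≤n (suc-injective ∘ cong proj₁)
      (λ i → □-adjˡ {Star n} {Star n} (centre-adj-leaf i)) (λ i → seed (∈-leafSquare⁺ i j))

    leaf-centre-activated : (i : Fin n) → Activated□ (suc i , zero)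
    leaf-centre-activated i = activated-by-family t≤n (suc-injective ∘ cong proj₂)
      (λ j → □-adjʳ {Star n} {Star n} (centre-adj-leaf j)) (λ j → seed (∈-leafSquare⁺ i j))

    centre-centre-activated : Activated□ (zero , zero)
    centre-centre-activated = activated-by-family t≤n (suc-injective ∘ cong proj₂)
      (λ j → □-adjʳ {Star n} {Star n} (centre-adj-leaf j)) centre-leaf-activated

    leafSquare-monopoly : IsDynMonopoly (Star n □ Star n) t leafSquare
    leafSquare-monopoly (suc i , suc j) = seed (∈-leafSquare⁺ i j)
    leafSquare-monopoly (suc i , zero)  = leaf-centre-activated i
    leafSquare-monopoly (zero  , suc j) = centre-leaf-activated j
    leafSquare-monopoly (zero  , zero)  = centre-centre-activated

  leafSquare⊆monopoly : ∀ {t D} → 3 ≤ t → IsDynMonopoly (Star n □ Star n) t D → leafSquare ⊆ D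
  leafSquare⊆monopoly 3≤t monopoly v∈ with ∈-leafSquare⁻ v∈
  ... | i , j , refl = activated-few-neighbours⇒seed leafSquare-neighbours 3≤t (monopoly (suc i , suc j))

theorem11 : (n t : ℕ) → 3 ≤ n → 3 ≤ t → t ≤ n →
            DynEq (Star n □ Star n) t (n * n)
theorem11 n t _ 3≤t t≤n =
  (leafSquare , leafSquare-unique , leafSquare-monopoly t≤n , length-leafSquare) ,
  λ D _ monopoly → subst (_≤ length D) length-leafSquare
                     (unique-⊆⇒length≤ leafSquare-unique (leafSquare⊆monopoly 3≤t monopoly))
  where open StarSquare n
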